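{- Let $p$ be an odd prime, $k\in\mathbb N$, $a\in\mathbb N_0$, and $m\in\mathbb N$ with $p\nmid m$, and put $n=p^am$. Then for every $\varepsilon>0$ there is a constant $c_\varepsilon>0$ (independent of $m$) such that \[ \left|\sum_{d\mid n}\left(\frac dp\right)d^k\right|\ge c_\varepsilon\, m^{k-\varepsilon}, \] and moreover \[ \operatorname{sgn}\left(\sum_{d\mid n}\left(\frac dp\right)d^k\right)=\left(\frac mp\right). \]
   Context: $\left(\frac{\cdot}{p}\right)$ is the Legendre symbol; sums run over positive divisors.
   Formalization: The parameter ε ranges over the positive rationals. -}

module Defs where

open import Data.Nat using (ℕ; zero; suc; _*_; _^_; _%_; _≡ᵇ_; NonZero)
open import Data.Nat.Divisibility using (_∣?_)
open import Data.Integer as ℤ using (ℤ; +_; -[1+_]; 0ℤ; 1ℤ; -1ℤ)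
open import Data.List using (List; map; filter; upTo; foldr)
open import Data.Bool.ListAction using (any)
open import Data.Bool using (if_then_else_)
open import Relation.Nullary.Decidable using (⌊_⌋)

legendre : (d p : ℕ) → .{{NonZero p}} → ℤ
legendre d p =
  if ⌊ p ∣? d ⌋ then 0ℤ
  else if any (λ x → ((x * x) % p) ≡ᵇ (d % p)) (upTo p) then 1ℤ
  else -1ℤ

divisors : ℕ → List ℕ
divisors n = filter (_∣? n) (map suc (upTo n))

legendreDivSum : (p k n : ℕ) → .{{NonZero p}} → ℤ
legendreDivSum p k n =
  foldr ℤ._+_ 0ℤ (map (λ d → legendre d p ℤ.* (+ (d ^ k))) (divisors n))

sgn : ℤ → ℤ
sgn (+ zero) = 0ℤ
sgn (+ suc _) = 1ℤ
sgn -[1+ _ ] = -1ℤ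

-- Put S(n) = Σ_{d ∣ n} (d/p) d^k. The Legendre symbol is completely multiplicative (the
-- product of two non-residues is a residue by a pigeonhole count of the p - 1 nonzero
-- classes), so d ↦ (d/p) d^k is too, and splitting off a prime power q^b of n gives
-- S(q^b r) = (1 + t + … + t^b) S(r) with t = (q/p) q^k. For q = p we have t = 0, so the
-- p-part of n is invisible; for q ≠ p, t = ±X with X = q^k and the geometric sum is
-- (q/p)^b V with X^b (X - 1) ≤ X V. Hence sgn S(m) = Π (q/p)^b = (m/p) and |S(m)| = Π V_q.
-- Raising to the v-th power, (q^{bk})^v ≤ (X/(X - 1))^v V^v, where the ratio is at most
-- 2 ≤ q^{bu} once q > 2v and at most 2^v for the finitely many primes q ≤ 2v; this gives
-- m^{kv} ≤ 2^{v(2v-1)} |S(m)|^v m^u, i.e. |S| ≫ m^{k - u/v}.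

module Submission where

open import Defs
open import Data.Bool using (Bool; true; false; if_then_else_; T)
open import Data.Bool.ListAction using (any)
open import Data.Empty using (⊥; ⊥-elim)
open import Data.Fin as Fin using (Fin; toℕ; fromℕ<; splitAt; join)
import Data.Fin.Properties as Finₚ
open import Data.Integer as ℤ using (ℤ; +_; -[1+_]; 0ℤ; 1ℤ; -1ℤ; ∣_∣)
import Data.Integer.Properties as ℤₚ
open import Data.List using (List; []; _∷_; map; upTo; foldr; _++_)
open import Data.List.Membership.Propositional using (_∈_; find)
open import Data.List.Membership.Propositional.Properties
  using (∈-upTo⁺; ∈-filter⁺; ∈-filter⁻; ∈-map⁺; ∈-map⁻; ∈-++⁺ˡ; ∈-++⁺ʳ; ∈-++⁻)
import Data.List.Relation.Unary.Any as Any
open import Data.List.Relation.Unary.Unique.Propositional using (Unique)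
import Data.List.Relation.Unary.Unique.Propositional.Properties as Uniqueₚ
open import Data.List.Properties using (map-∘; map-cong)
open import Data.List.Membership.Propositional.Properties.WithK using (unique∧set⇒bag)
open import Data.List.Relation.Binary.BagAndSetEquality using (∼bag⇒↭)
open import Data.List.Relation.Binary.Permutation.Propositional using (_↭_; ↭⇒↭ₛ)
import Data.List.Relation.Binary.Permutation.Propositional.Properties as Permₚ
open import Data.List.Relation.Binary.Permutation.Setoid.Properties using (foldr-commMonoid)
import Data.List.Relation.Unary.Any.Properties as Anyₚ
open import Data.Nat as ℕ
  using (ℕ; zero; suc; _+_; _*_; _∸_; _^_; _%_; _/_; _≤_; _<_; z≤n; s≤s; NonZero;
         _≟_; _<?_; >-nonZero; ≢-nonZero⁻¹; nonTrivial⇒n>1; n>1⇒nonTrivial)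
open import Data.Nat.Properties
open import Data.Nat.DivMod using (m%n%n≡m%n; %-distribˡ-*; m%n<n; m≡m%n+[m/n]*n; [m+kn]%n≡m%n)
open import Data.Nat.Divisibility
open import Data.Nat.Primality
  using (Prime; prime⇒irreducible; prime⇒nonTrivial; prime⇒nonZero; euclidsLemma;
         _Rough_; 2-rough; rough⇒≤; ∤⇒rough-suc; rough∧∣⇒rough; rough∧∣⇒prime)
open import Data.Nat.Induction using (<-rec)
open import Data.Nat.Coprimality using (Coprime; coprime-Bézout; coprime-divisor)
  renaming (sym to Coprime-sym)
open import Data.Nat.GCD using (module Bézout)
open import Data.Nat.Tactic.RingSolver using (solve-∀)
open import Data.Integer.Tactic.RingSolver using () renaming (solve-∀ to ℤ-solve-∀)
open import Data.Product using (Σ; ∃; ∃₂; _×_; _,_; proj₁; proj₂)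
open import Data.Sum using (_⊎_; inj₁; inj₂; [_,_]′)
open import Function using (_∘_; _⇔_; mk⇔)
open import Relation.Nullary using (¬_; Dec; yes; no; does; contradiction)
open import Relation.Nullary.Decidable using (⌊_⌋; isYes≗does; map′; T?; dec-true; dec-false)
open import Relation.Binary.PropositionalEquality

prime⇒1< : ∀ {p} → Prime p → 1 < p
prime⇒1< {p} p-prime = nonTrivial⇒n>1 p {{prime⇒nonTrivial p-prime}}

m≤m^n : ∀ m .{{_ : NonZero m}} {n} → 1 ≤ n → m ≤ m ^ n
m≤m^n m {n} 1≤n = subst (_≤ m ^ n) (^-identityʳ m) (^-monoʳ-≤ m 1≤n)

prime∤⇒coprime : ∀ {p n} → Prime p → ¬ p ∣ n → Coprime p n
prime∤⇒coprime p-prime p∤n (i∣p , i∣n) with prime⇒irreducible p-prime i∣p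
... | inj₁ i≡1  = i≡1
... | inj₂ refl = contradiction i∣n p∤n

∣∧<⇒≡0 : ∀ {p n} → p ∣ n → n < p → n ≡ 0
∣∧<⇒≡0 {n = zero}  _   _   = refl
∣∧<⇒≡0 {n = suc n} p∣n n<p = contradiction (∣⇒≤ p∣n) (<⇒≱ n<p)

^-distribʳ-* : ∀ m n o → (m * n) ^ o ≡ m ^ o * n ^ o
^-distribʳ-* m n zero    = refl
^-distribʳ-* m n (suc o) = trans (cong (m * n *_) (^-distribʳ-* m n o)) (interchange m n (m ^ o) (n ^ o))
  where
  interchange : ∀ a b c d → a * b * (c * d) ≡ a * c * (b * d)
  interchange = solve-∀

ℤ-^-distribʳ-* : ∀ x y n → (x ℤ.* y) ℤ.^ n ≡ x ℤ.^ n ℤ.* y ℤ.^ n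
ℤ-^-distribʳ-* x y zero    = refl
ℤ-^-distribʳ-* x y (suc n) = trans (cong (x ℤ.* y ℤ.*_) (ℤ-^-distribʳ-* x y n))
                                    (interchange x y (x ℤ.^ n) (y ℤ.^ n))
  where
  interchange : ∀ a b c d → a ℤ.* b ℤ.* (c ℤ.* d) ≡ a ℤ.* c ℤ.* (b ℤ.* d)
  interchange = ℤ-solve-∀

pos-^ : ∀ m n → (+ m) ℤ.^ n ≡ + (m ^ n)
pos-^ m zero    = refl
pos-^ m (suc n) = trans (cong (+ m ℤ.*_) (pos-^ m n)) (sym (ℤₚ.pos-* m (m ^ n)))

data IsUnit : ℤ → Set where
  unit⁺ : IsUnit 1ℤ
  unit⁻ : IsUnit -1ℤ

IsUnit-* : ∀ {s t} → IsUnit s → IsUnit t → IsUnit (s ℤ.* t)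
IsUnit-* unit⁺ unit⁺ = unit⁺
IsUnit-* unit⁺ unit⁻ = unit⁻
IsUnit-* unit⁻ unit⁺ = unit⁻
IsUnit-* unit⁻ unit⁻ = unit⁺

IsUnit-^ : ∀ {s} → IsUnit s → ∀ b → IsUnit (s ℤ.^ b)
IsUnit-^ s± zero    = unit⁺
IsUnit-^ s± (suc b) = IsUnit-* s± (IsUnit-^ s± b)

sgn-* : ∀ x y → sgn (x ℤ.* y) ≡ sgn x ℤ.* sgn y
sgn-* (+ zero)   y          = refl
sgn-* (+ suc m)  (+ zero)   = cong sgn (ℤₚ.*-zeroʳ (+ suc m))
sgn-* (+ suc m)  (+ suc n)  = refl
sgn-* (+ suc m)  -[1+ n ]   = refl
sgn-* -[1+ m ]   (+ zero)   = cong sgn (ℤₚ.*-zeroʳ -[1+ m ])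
sgn-* -[1+ m ]   (+ suc n)  = refl
sgn-* -[1+ m ]   -[1+ n ]   = refl

sgn-unit-* : ∀ {s V} → IsUnit s → 1 ≤ V → sgn (s ℤ.* + V) ≡ s
sgn-unit-* {V = suc _} unit⁺ _ = refl
sgn-unit-* {V = suc _} unit⁻ _ = refl

∣unit-*∣ : ∀ {s} V → IsUnit s → ∣ s ℤ.* + V ∣ ≡ V
∣unit-*∣ V unit⁺ = trans (ℤₚ.abs-* 1ℤ (+ V)) (*-identityˡ V)
∣unit-*∣ V unit⁻ = trans (ℤₚ.abs-* -1ℤ (+ V)) (*-identityˡ V)

module QuadraticResidues {p : ℕ} .{{_ : NonZero p}} (p-prime : Prime p) where

  infix 4 _≈_
  _≈_ : ℕ → ℕ → Set
  a ≈ b = a % p ≡ b % p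

  %-≈ : ∀ a → a % p ≈ a
  %-≈ a = m%n%n≡m%n a p

  *-cong-≈ : ∀ {a b c d} → a ≈ b → c ≈ d → a * c ≈ b * d
  *-cong-≈ {a} {b} {c} {d} a≈b c≈d = begin
    (a * c) % p             ≡⟨ %-distribˡ-* a c p ⟩
    ((a % p) * (c % p)) % p ≡⟨ cong₂ (λ x y → (x * y) % p) a≈b c≈d ⟩
    ((b % p) * (d % p)) % p ≡⟨ %-distribˡ-* b d p ⟨
    (b * d) % p             ∎
    where open ≡-Reasoning

  ≈-resp-∣ : ∀ {a b} → a ≈ b → p ∣ a → p ∣ b
  ≈-resp-∣ {a} {b} a≈b p∣a = m%n≡0⇒n∣m b p (trans (sym a≈b) (n∣m⇒m%n≡0 a p p∣a))

  ∤-* : ∀ {a b} → ¬ p ∣ a → ¬ p ∣ b → ¬ p ∣ a * b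
  ∤-* {a} {b} p∤a p∤b p∣ab = [ p∤a , p∤b ]′ (euclidsLemma a b p-prime p∣ab)

  ∤-< : ∀ {x} → 1 ≤ x → x < p → ¬ p ∣ x
  ∤-< {suc x} _ x<p p∣x = contradiction (∣∧<⇒≡0 p∣x x<p) λ ()

  ≈⇒∣∸ : ∀ {a b} → a ≈ b → p ∣ a ∸ b
  ≈⇒∣∸ {a} {b} a≈b = divides (a / p ∸ b / p) (begin
    a ∸ b                                     ≡⟨ cong₂ _∸_ (m≡m%n+[m/n]*n a p) (m≡m%n+[m/n]*n b p) ⟩
    (a % p + a / p * p) ∸ (b % p + b / p * p) ≡⟨ cong (λ x → (a % p + a / p * p) ∸ (x + b / p * p)) a≈b ⟨
    (a % p + a / p * p) ∸ (a % p + b / p * p) ≡⟨ [m+n]∸[m+o]≡n∸o (a % p) _ _ ⟩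
    a / p * p ∸ b / p * p                     ≡⟨ *-distribʳ-∸ p (a / p) (b / p) ⟨
    (a / p ∸ b / p) * p                       ∎)
    where open ≡-Reasoning

  private
    square-∸ : ∀ x y → x * x ∸ y * y ≡ (x + y) * (x ∸ y)
    square-∸ x y = begin
      x * x ∸ y * y                     ≡⟨ [m+n]∸[m+o]≡n∸o (y * x) (x * x) (y * y) ⟨
      (y * x + x * x) ∸ (y * x + y * y) ≡⟨ cong₂ _∸_ (distribˡ x y) (distribʳ x y) ⟩
      (x + y) * x ∸ (x + y) * y         ≡⟨ *-distribˡ-∸ (x + y) x y ⟨
      (x + y) * (x ∸ y)                 ∎
      where
      open ≡-Reasoning
      distribˡ : ∀ x y → y * x + x * x ≡ (x + y) * x
      distribˡ = solve-∀
      distribʳ : ∀ x y → y * x + y * y ≡ (x + y) * y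
      distribʳ = solve-∀

    squares-injective-≤ : ∀ {x y} → 1 ≤ x → x + y < p → y ≤ x → x * x ≈ y * y → x ≡ y
    squares-injective-≤ {x} {y} 1≤x x+y<p y≤x x²≈y²
      with euclidsLemma (x + y) (x ∸ y) p-prime (subst (p ∣_) (square-∸ x y) (≈⇒∣∸ x²≈y²))
    ... | inj₁ p∣x+y = contradiction p∣x+y (∤-< (≤-trans 1≤x (m≤m+n x y)) x+y<p)
    ... | inj₂ p∣x∸y = ≤-antisym (m∸n≡0⇒m≤n (∣∧<⇒≡0 p∣x∸y x∸y<p)) y≤x
      where x∸y<p = ≤-<-trans (m∸n≤m x y) (≤-<-trans (m≤m+n x y) x+y<p)

  -- The bound x + y < p excludes the other square root p - x of x².
  squares-injective : ∀ {x y} → 1 ≤ x → 1 ≤ y → x + y < p → x * x ≈ y * y → x ≡ y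
  squares-injective {x} {y} 1≤x 1≤y x+y<p x²≈y² with ≤-total y x
  ... | inj₁ y≤x = squares-injective-≤ 1≤x x+y<p y≤x x²≈y²
  ... | inj₂ x≤y = sym (squares-injective-≤ 1≤y (subst (_< p) (+-comm x y) x+y<p) x≤y (sym x²≈y²))

  inverse : ∀ {a} → ¬ p ∣ a → ∃ λ a⁻¹ → a * a⁻¹ ≈ 1
  inverse {a} p∤a with coprime-Bézout (prime∤⇒coprime p-prime p∤a)
  ... | Bézout.-+ x y 1+xp≡ya = y , (begin
    (a * y) % p     ≡⟨ cong (_% p) (trans (*-comm a y) (sym 1+xp≡ya)) ⟩
    (1 + x * p) % p ≡⟨ [m+kn]%n≡m%n 1 x p ⟩
    1 % p           ∎)
    where open ≡-Reasoning
  -- Here a * y ≡ -1, so y * a * y is an inverse: (ay)² + 2xp = (ay + 1)² + 1 = (xp)² + 1.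
  ... | Bézout.+- x y 1+ya≡xp = y * a * y , (begin
    (a * (y * a * y)) % p                 ≡⟨ cong (_% p) (regroup a y) ⟩
    ((a * y) * (a * y)) % p               ≡⟨ [m+kn]%n≡m%n _ (2 * x) p ⟨
    ((a * y) * (a * y) + 2 * x * p) % p   ≡⟨ cong (_% p) key ⟩
    (1 + (x * x * p) * p) % p             ≡⟨ [m+kn]%n≡m%n 1 (x * x * p) p ⟩
    1 % p                                 ∎)
    where
    open ≡-Reasoning
    square-identity : ∀ z → z * z + 2 * (1 + z) ≡ 1 + (1 + z) * (1 + z)
    square-identity = solve-∀
    regroup : ∀ a y → a * (y * a * y) ≡ (a * y) * (a * y)
    regroup = solve-∀
    regroup′ : ∀ x p → (x * p) * (x * p) ≡ (x * x * p) * p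
    regroup′ = solve-∀
    1+ay≡xp : 1 + a * y ≡ x * p
    1+ay≡xp = trans (cong suc (*-comm a y)) 1+ya≡xp
    key : (a * y) * (a * y) + 2 * x * p ≡ 1 + (x * x * p) * p
    key = begin
      (a * y) * (a * y) + 2 * x * p         ≡⟨ cong (λ z → (a * y) * (a * y) + z) (*-assoc 2 x p) ⟩
      (a * y) * (a * y) + 2 * (x * p)       ≡⟨ cong (λ z → (a * y) * (a * y) + 2 * z) 1+ay≡xp ⟨
      (a * y) * (a * y) + 2 * (1 + a * y)   ≡⟨ square-identity (a * y) ⟩
      1 + (1 + a * y) * (1 + a * y)         ≡⟨ cong (λ z → 1 + z * z) 1+ay≡xp ⟩
      1 + (x * p) * (x * p)                 ≡⟨ cong suc (regroup′ x p) ⟩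
      1 + (x * x * p) * p                   ∎

  ≈-cancelˡ : ∀ {a u v} → ¬ p ∣ a → a * u ≈ a * v → u ≈ v
  ≈-cancelˡ {a} {u} {v} p∤a au≈av = begin
    u % p               ≡⟨ cong (_% p) (*-identityˡ u) ⟨
    (1 * u) % p         ≡⟨ *-cong-≈ aa⁻¹≈1 refl ⟨
    ((a * a⁻¹) * u) % p ≡⟨ cong (_% p) (regroup a a⁻¹ u) ⟩
    (a⁻¹ * (a * u)) % p ≡⟨ *-cong-≈ {a⁻¹} refl au≈av ⟩
    (a⁻¹ * (a * v)) % p ≡⟨ cong (_% p) (regroup a a⁻¹ v) ⟨
    ((a * a⁻¹) * v) % p ≡⟨ *-cong-≈ aa⁻¹≈1 refl ⟩
    (1 * v) % p         ≡⟨ cong (_% p) (*-identityˡ v) ⟩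
    v % p               ∎
    where
    open ≡-Reasoning
    a⁻¹ = proj₁ (inverse p∤a)
    aa⁻¹≈1 = proj₂ (inverse p∤a)
    regroup : ∀ a b c → (a * b) * c ≡ b * (a * c)
    regroup = solve-∀

  QR : ℕ → Set
  QR d = ∃ λ x → x * x ≈ d

  QR-reduce : ∀ {d} → QR d → ∃ λ x → x < p × x * x ≈ d
  QR-reduce (x , x²≈d) = x % p , m%n<n x p , trans (*-cong-≈ (%-≈ x) (%-≈ x)) x²≈d

  -- The test performed inside the definition of `legendre`.
  hasSquareRoot : ℕ → Bool
  hasSquareRoot d = any (λ x → ((x * x) % p) ℕ.≡ᵇ (d % p)) (upTo p)

  QR? : ∀ d → Dec (QR d)
  QR? d = map′ from to (T? (hasSquareRoot d))
    where
    from : T (hasSquareRoot d) → QR d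
    from t = let (x , _ , t′) = find (Anyₚ.any⁻ _ (upTo p) t) in x , ≡ᵇ⇒≡ _ _ t′
    to : QR d → T (hasSquareRoot d)
    to qr = let (x , x<p , x²≈d) = QR-reduce qr in
      Anyₚ.any⁺ _ (Any.map (λ { refl → ≡⇒≡ᵇ _ _ x²≈d }) (∈-upTo⁺ x<p))

  private
    select : Bool → Bool → ℤ
    select divisible residue = if divisible then 0ℤ else if residue then 1ℤ else -1ℤ

    ⌊p∣?⌋-true : ∀ {d} → p ∣ d → ⌊ p ∣? d ⌋ ≡ true
    ⌊p∣?⌋-true {d} p∣d = trans (isYes≗does (p ∣? d)) (dec-true (p ∣? d) p∣d)

    ⌊p∣?⌋-false : ∀ {d} → ¬ p ∣ d → ⌊ p ∣? d ⌋ ≡ false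
    ⌊p∣?⌋-false {d} p∤d = trans (isYes≗does (p ∣? d)) (dec-false (p ∣? d) p∤d)

  legendre-∣ : ∀ {d} → p ∣ d → legendre d p ≡ 0ℤ
  legendre-∣ {d} p∣d = cong (λ c → select c (does (QR? d))) (⌊p∣?⌋-true p∣d)

  legendre-QR : ∀ {d} → ¬ p ∣ d → QR d → legendre d p ≡ 1ℤ
  legendre-QR {d} p∤d qr = cong₂ select (⌊p∣?⌋-false p∤d) (dec-true (QR? d) qr)

  legendre-¬QR : ∀ {d} → ¬ p ∣ d → ¬ QR d → legendre d p ≡ -1ℤ
  legendre-¬QR {d} p∤d ¬qr = cong₂ select (⌊p∣?⌋-false p∤d) (dec-false (QR? d) ¬qr)

  legendre-1 : legendre 1 p ≡ 1ℤ
  legendre-1 = legendre-QR (∤-< ≤-refl (prime⇒1< p-prime)) (1 , refl)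

  QR-* : ∀ {a b} → QR a → QR b → QR (a * b)
  QR-* (x , x²≈a) (y , y²≈b) = x * y , trans (cong (_% p) (interchange x y)) (*-cong-≈ x²≈a y²≈b)
    where
    interchange : ∀ x y → (x * y) * (x * y) ≡ (x * x) * (y * y)
    interchange = solve-∀

  QR-÷ : ∀ {a x y} → ¬ p ∣ y → x * x ≈ a * (y * y) → QR a
  QR-÷ {a} {x} {y} p∤y x²≈ay² = x * y⁻¹ , (begin
    ((x * y⁻¹) * (x * y⁻¹)) % p       ≡⟨ cong (_% p) (interchange x y⁻¹) ⟩
    ((x * x) * (y⁻¹ * y⁻¹)) % p       ≡⟨ *-cong-≈ x²≈ay² refl ⟩
    ((a * (y * y)) * (y⁻¹ * y⁻¹)) % p ≡⟨ cong (_% p) (regroup a y y⁻¹) ⟩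
    (a * ((y * y⁻¹) * (y * y⁻¹))) % p ≡⟨ *-cong-≈ {a} refl (*-cong-≈ yy⁻¹≈1 yy⁻¹≈1) ⟩
    (a * 1) % p                       ≡⟨ cong (_% p) (*-identityʳ a) ⟩
    a % p                             ∎)
    where
    open ≡-Reasoning
    y⁻¹ = proj₁ (inverse p∤y)
    yy⁻¹≈1 = proj₂ (inverse p∤y)
    interchange : ∀ x y → (x * y) * (x * y) ≡ (x * x) * (y * y)
    interchange = solve-∀
    regroup : ∀ a y z → (a * (y * y)) * (z * z) ≡ a * ((y * z) * (y * z))
    regroup = solve-∀

  QR-*-¬QR : ∀ {a b} → ¬ p ∣ a → QR a → ¬ QR b → ¬ QR (a * b)
  QR-*-¬QR {a} {b} p∤a (x , x²≈a) b∉QR (z , z²≈ab) = b∉QR (QR-÷ {x = z} p∤x (begin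
    (z * z) % p       ≡⟨ z²≈ab ⟩
    (a * b) % p       ≡⟨ cong (_% p) (*-comm a b) ⟩
    (b * a) % p       ≡⟨ *-cong-≈ {b} refl x²≈a ⟨
    (b * (x * x)) % p ∎))
    where
    open ≡-Reasoning
    p∤x : ¬ p ∣ x
    p∤x p∣x = p∤a (≈-resp-∣ x²≈a (∣m⇒∣m*n x p∣x))

  odd-prime : p ≢ 2 → ∃ λ h → p ≡ suc (h + h)
  odd-prime p≢2 with p % 2 in p%2≡r | m%n<n p 2
  ... | 0 | _ with prime⇒irreducible p-prime (m%n≡0⇒n∣m p 2 p%2≡r)
  ...   | inj₁ ()
  ...   | inj₂ 2≡p = contradiction (sym 2≡p) p≢2
  odd-prime p≢2 | 1 | _ = p / 2 , (begin
    p                 ≡⟨ m≡m%n+[m/n]*n p 2 ⟩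
    p % 2 + p / 2 * 2 ≡⟨ cong (_+ p / 2 * 2) p%2≡r ⟩
    1 + p / 2 * 2     ≡⟨ double (p / 2) ⟩
    suc (p / 2 + p / 2) ∎)
    where
    open ≡-Reasoning
    double : ∀ h → 1 + h * 2 ≡ suc (h + h)
    double = solve-∀
  odd-prime p≢2 | suc (suc _) | s≤s (s≤s ())

  -- If a and b are non-residues and b is not a times a square, then the p numbers
  -- 1², …, h², a·1², …, a·h², b (p = 2h + 1) are pairwise incongruent and prime to p:
  -- too many for the p - 1 nonzero residue classes.
  private
    module Pigeonhole {h : ℕ} (p≡ : p ≡ suc (h + h)) {a b : ℕ}
        (p∤a : ¬ p ∣ a) (a∉QR : ¬ QR a) (p∤b : ¬ p ∣ b) (b∉QR : ¬ QR b)
        (b≉a·□ : ∀ x → ¬ a * (x * x) ≈ b) where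

      root : Fin h → ℕ
      root i = suc (toℕ i)

      root<p : ∀ i → root i < p
      root<p i = subst (root i <_) (sym p≡) (s≤s (≤-trans (Finₚ.toℕ<n i) (m≤m+n h h)))

      p∤root : ∀ i → ¬ p ∣ root i
      p∤root i = ∤-< (s≤s z≤n) (root<p i)

      roots-injective : ∀ {i j} → root i * root i ≈ root j * root j → i ≡ j
      roots-injective {i} {j} i²≈j² = Finₚ.toℕ-injective (suc-injective
        (squares-injective {root i} {root j} (s≤s z≤n) (s≤s z≤n) root-sum<p i²≈j²))
        where
        root-sum<p : root i + root j < p
        root-sum<p = subst (root i + root j <_) (sym p≡) (s≤s (+-mono-≤ (Finₚ.toℕ<n i) (Finₚ.toℕ<n j)))

      value : Fin h ⊎ Fin h → ℕ
      value (inj₁ i) = root i * root i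
      value (inj₂ i) = a * (root i * root i)

      value-injective : ∀ s t → value s ≈ value t → s ≡ t
      value-injective (inj₁ i) (inj₁ j) e = cong inj₁ (roots-injective e)
      value-injective (inj₁ i) (inj₂ j) e = contradiction (QR-÷ {x = root i} (p∤root j) e) a∉QR
      value-injective (inj₂ i) (inj₁ j) e = contradiction (QR-÷ {x = root j} (p∤root i) (sym e)) a∉QR
      value-injective (inj₂ i) (inj₂ j) e = cong inj₂ (roots-injective (≈-cancelˡ p∤a e))

      b≉value : ∀ s → ¬ b ≈ value s
      b≉value (inj₁ i) e = b∉QR (root i , sym e)
      b≉value (inj₂ i) e = b≉a·□ (root i) (sym e)

      p∤value : ∀ s → ¬ p ∣ value s
      p∤value (inj₁ i) = ∤-* (p∤root i) (p∤root i)
      p∤value (inj₂ i) = ∤-* p∤a (∤-* (p∤root i) (p∤root i))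

      candidate : Fin (suc (h + h)) → ℕ
      candidate Fin.zero    = b
      candidate (Fin.suc i) = value (splitAt h i)

      candidate-injective : ∀ i j → candidate i ≈ candidate j → i ≡ j
      candidate-injective Fin.zero    Fin.zero    _ = refl
      candidate-injective Fin.zero    (Fin.suc j) e = contradiction e (b≉value (splitAt h j))
      candidate-injective (Fin.suc i) Fin.zero    e = contradiction (sym e) (b≉value (splitAt h i))
      candidate-injective (Fin.suc i) (Fin.suc j) e = cong Fin.suc (begin
        i                      ≡⟨ Finₚ.join-splitAt h h i ⟨
        join h h (splitAt h i) ≡⟨ cong (join h h) (value-injective (splitAt h i) (splitAt h j) e) ⟩
        join h h (splitAt h j) ≡⟨ Finₚ.join-splitAt h h j ⟩
        j                      ∎)
        where open ≡-Reasoning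

      p∤candidate : ∀ i → ¬ p ∣ candidate i
      p∤candidate Fin.zero    = p∤b
      p∤candidate (Fin.suc i) = p∤value (splitAt h i)

      residue-pos : ∀ i → 1 ≤ candidate i % p
      residue-pos i = n≢0⇒n>0 (p∤candidate i ∘ m%n≡0⇒n∣m _ p)

      slot : Fin (suc (h + h)) → Fin (h + h)
      slot i = fromℕ< (subst (_≤ h + h) (sym (m+[n∸m]≡n (residue-pos i)))
                         (≤-pred (subst (candidate i % p <_) p≡ (m%n<n (candidate i) p))))

      contradiction-from-pigeonhole : ⊥
      contradiction-from-pigeonhole with Finₚ.pigeonhole ≤-refl slot
      ... | i , j , i<j , slot-i≡slot-j = Finₚ.<-irrefl (candidate-injective i j residues-equal) i<j
        where
        residues-equal : candidate i ≈ candidate j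
        residues-equal = ∸-cancelʳ-≡ (residue-pos i) (residue-pos j)
          (trans (sym (Finₚ.toℕ-fromℕ< _)) (trans (cong toℕ slot-i≡slot-j) (Finₚ.toℕ-fromℕ< _)))

  ¬QR-*-¬QR : p ≢ 2 → ∀ {a b} → ¬ p ∣ a → ¬ QR a → ¬ p ∣ b → ¬ QR b → QR (a * b)
  ¬QR-*-¬QR p≢2 {a} {b} p∤a a∉QR p∤b b∉QR
    with anyUpTo? (λ x → (a * (x * x)) % p ≟ b % p) p
  ... | yes (x , _ , ax²≈b) = a * x , trans (cong (_% p) (regroup a x)) (*-cong-≈ {a} refl ax²≈b)
    where
    regroup : ∀ a x → (a * x) * (a * x) ≡ a * (a * (x * x))
    regroup = solve-∀
  ... | no ∄x = ⊥-elim (Pigeonhole.contradiction-from-pigeonhole {proj₁ (odd-prime p≢2)}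
                          (proj₂ (odd-prime p≢2)) p∤a a∉QR p∤b b∉QR b≉a·□)
    where
    b≉a·□ : ∀ x → ¬ a * (x * x) ≈ b
    b≉a·□ x ax²≈b = ∄x (x % p , m%n<n x p ,
      trans (*-cong-≈ {a} refl (*-cong-≈ (%-≈ x) (%-≈ x))) ax²≈b)

  legendre-unit : ∀ {d} → ¬ p ∣ d → IsUnit (legendre d p)
  legendre-unit {d} p∤d with QR? d
  ... | yes qr = subst IsUnit (sym (legendre-QR p∤d qr)) unit⁺
  ... | no ¬qr = subst IsUnit (sym (legendre-¬QR p∤d ¬qr)) unit⁻

  legendre-* : p ≢ 2 → ∀ a b → legendre (a * b) p ≡ legendre a p ℤ.* legendre b p
  legendre-* p≢2 a b = by-divisibility (p ∣? a) (p ∣? b)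
    where
    open ≡-Reasoning
    ProductRule : Set
    ProductRule = legendre (a * b) p ≡ legendre a p ℤ.* legendre b p

    by-residuosity : ¬ p ∣ a → ¬ p ∣ b → Dec (QR a) → Dec (QR b) → ProductRule
    by-residuosity p∤a p∤b (yes qa) (yes qb) =
      trans (legendre-QR (∤-* p∤a p∤b) (QR-* qa qb))
            (sym (cong₂ ℤ._*_ (legendre-QR p∤a qa) (legendre-QR p∤b qb)))
    by-residuosity p∤a p∤b (yes qa) (no nb) =
      trans (legendre-¬QR (∤-* p∤a p∤b) (QR-*-¬QR p∤a qa nb))
            (sym (cong₂ ℤ._*_ (legendre-QR p∤a qa) (legendre-¬QR p∤b nb)))
    by-residuosity p∤a p∤b (no na) (yes qb) =
      trans (legendre-¬QR (∤-* p∤a p∤b) (QR-*-¬QR p∤b qb na ∘ subst QR (*-comm a b)))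
            (sym (cong₂ ℤ._*_ (legendre-¬QR p∤a na) (legendre-QR p∤b qb)))
    by-residuosity p∤a p∤b (no na) (no nb) =
      trans (legendre-QR (∤-* p∤a p∤b) (¬QR-*-¬QR p≢2 p∤a na p∤b nb))
            (sym (cong₂ ℤ._*_ (legendre-¬QR p∤a na) (legendre-¬QR p∤b nb)))

    by-divisibility : Dec (p ∣ a) → Dec (p ∣ b) → ProductRule
    by-divisibility (yes p∣a) _ = begin
      legendre (a * b) p            ≡⟨ legendre-∣ (∣m⇒∣m*n b p∣a) ⟩
      0ℤ ℤ.* legendre b p           ≡⟨ cong (ℤ._* legendre b p) (legendre-∣ p∣a) ⟨
      legendre a p ℤ.* legendre b p ∎
    by-divisibility (no _) (yes p∣b) = begin
      legendre (a * b) p            ≡⟨ legendre-∣ (∣n⇒∣m*n a p∣b) ⟩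
      0ℤ                            ≡⟨ ℤₚ.*-zeroʳ (legendre a p) ⟨
      legendre a p ℤ.* 0ℤ           ≡⟨ cong (legendre a p ℤ.*_) (legendre-∣ p∣b) ⟨
      legendre a p ℤ.* legendre b p ∎
    by-divisibility (no p∤a) (no p∤b) = by-residuosity p∤a p∤b (QR? a) (QR? b)

-- Divisor sums

sumℤ : (ℕ → ℤ) → List ℕ → ℤ
sumℤ f xs = foldr ℤ._+_ 0ℤ (map f xs)

sumℤ-++ : ∀ f xs ys → sumℤ f (xs ++ ys) ≡ sumℤ f xs ℤ.+ sumℤ f ys
sumℤ-++ f []       ys = sym (ℤₚ.+-identityˡ _)
sumℤ-++ f (x ∷ xs) ys = trans (cong (λ s → f x ℤ.+ s) (sumℤ-++ f xs ys)) (sym (ℤₚ.+-assoc (f x) _ _))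

sumℤ-map : ∀ f g xs → sumℤ f (map g xs) ≡ sumℤ (f ∘ g) xs
sumℤ-map f g xs = cong (foldr ℤ._+_ 0ℤ) (sym (map-∘ xs))

sumℤ-cong : ∀ {f g} xs → (∀ x → f x ≡ g x) → sumℤ f xs ≡ sumℤ g xs
sumℤ-cong xs f≗g = cong (foldr ℤ._+_ 0ℤ) (map-cong f≗g xs)

sumℤ-*ˡ : ∀ c f xs → sumℤ (λ x → c ℤ.* f x) xs ≡ c ℤ.* sumℤ f xs
sumℤ-*ˡ c f []       = sym (ℤₚ.*-zeroʳ c)
sumℤ-*ˡ c f (x ∷ xs) = trans (cong (λ s → c ℤ.* f x ℤ.+ s) (sumℤ-*ˡ c f xs)) (sym (ℤₚ.*-distribˡ-+ c (f x) _))

sumℤ-↭ : ∀ f {xs ys} → xs ↭ ys → sumℤ f xs ≡ sumℤ f ys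
sumℤ-↭ f xs↭ys = foldr-commMonoid (setoid ℤ) ℤₚ.+-0-isCommutativeMonoid (↭⇒↭ₛ (Permₚ.map⁺ f xs↭ys))

sumℤ-unique-⇔ : ∀ f {xs ys} → Unique xs → Unique ys → (∀ {x} → x ∈ xs ⇔ x ∈ ys) →
                sumℤ f xs ≡ sumℤ f ys
sumℤ-unique-⇔ f xs! ys! xs⇔ys = sumℤ-↭ f (∼bag⇒↭ (unique∧set⇒bag xs! ys! xs⇔ys))

∈-divisors⁺ : ∀ {d n} → 1 ≤ n → d ∣ n → d ∈ divisors n
∈-divisors⁺ {zero}  {suc n} _ 0∣n = contradiction (0∣⇒≡0 0∣n) λ ()
∈-divisors⁺ {suc d} {suc n} _ d∣n = ∈-filter⁺ (_∣? suc n) (∈-map⁺ suc (∈-upTo⁺ (∣⇒≤ d∣n))) d∣n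

∈-divisors⁻ : ∀ {d} n → d ∈ divisors n → d ∣ n
∈-divisors⁻ n d∈ = proj₂ (∈-filter⁻ (_∣? n) {xs = map suc (upTo n)} d∈)

divisors-unique : ∀ n → Unique (divisors n)
divisors-unique n = Uniqueₚ.filter⁺ (_∣? n) (Uniqueₚ.map⁺ suc-injective (Uniqueₚ.upTo⁺ n))

-- Divisors of q^b r

factorOut : ∀ {q} → 1 < q → ∀ y → 1 ≤ y → ∃₂ λ j e → y ≡ q ^ j * e × ¬ q ∣ e
factorOut {q} 1<q = <-rec (λ y → 1 ≤ y → ∃₂ λ j e → y ≡ q ^ j * e × ¬ q ∣ e) step
  where
  step : ∀ y → (∀ {z} → z < y → 1 ≤ z → ∃₂ λ j e → z ≡ q ^ j * e × ¬ q ∣ e) →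
         1 ≤ y → ∃₂ λ j e → y ≡ q ^ j * e × ¬ q ∣ e
  step y rec 1≤y with q ∣? y
  ... | no q∤y = 0 , y , sym (*-identityˡ y) , q∤y
  ... | yes (divides z y≡zq) with z
  ...   | zero = contradiction y≡zq (≢-nonZero⁻¹ y {{>-nonZero 1≤y}})
  ...   | suc z′ with rec (subst (suc z′ <_) (sym y≡zq) (m<m*n (suc z′) q 1<q)) (s≤s z≤n)
  ...     | j , e , z≡ , q∤e = suc j , e , (begin
    y               ≡⟨ y≡zq ⟩
    suc z′ * q      ≡⟨ cong (_* q) z≡ ⟩
    q ^ j * e * q   ≡⟨ regroup (q ^ j) e q ⟩
    q * q ^ j * e   ∎) , q∤e
    where
    open ≡-Reasoning
    regroup : ∀ a e q → a * e * q ≡ q * a * e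
    regroup = solve-∀

primePower-split : ∀ {q m} → 1 < q → q ∣ m → 1 ≤ m →
                   ∃₂ λ b r → m ≡ q ^ b * r × 1 ≤ b × 1 ≤ r × ¬ q ∣ r
primePower-split {q} {m} 1<q q∣m 1≤m with factorOut 1<q m 1≤m
... | zero  , r , m≡r , q∤r = contradiction (subst (q ∣_) (trans m≡r (*-identityˡ r)) q∣m) q∤r
... | suc b , zero , m≡0 , _ = contradiction (trans m≡0 (*-zeroʳ (q ^ suc b))) (≢-nonZero⁻¹ m {{>-nonZero 1≤m}})
... | suc b , suc r , m≡ , q∤r = suc b , suc r , m≡ , s≤s z≤n , s≤s z≤n , q∤r

^*-exponent-unique : ∀ {q} .{{_ : NonZero q}} j j′ {e e′} →
                     q ^ j * e ≡ q ^ j′ * e′ → ¬ q ∣ e → ¬ q ∣ e′ → j ≡ j′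
^*-exponent-unique         zero    zero     _  _   _    = refl
^*-exponent-unique {q}     zero    (suc j′) {e} {e′} eq q∤e _ =
  contradiction (subst (q ∣_) (trans (sym eq) (*-identityˡ e)) (∣-trans (m∣m*n (q ^ j′)) (m∣m*n e′))) q∤e
^*-exponent-unique {q}     (suc j) zero     {e} {e′} eq _ q∤e′ =
  contradiction (subst (q ∣_) (trans eq (*-identityˡ e′)) (∣-trans (m∣m*n (q ^ j)) (m∣m*n e))) q∤e′
^*-exponent-unique {q}     (suc j) (suc j′) {e} {e′} eq q∤e q∤e′ = cong suc
  (^*-exponent-unique j j′ (*-cancelˡ-≡ _ _ q (trans (sym (*-assoc q (q ^ j) e)) (trans eq (*-assoc q (q ^ j′) e′))))
                      q∤e q∤e′)

^∣^*⇒≤ : ∀ {q r} → Prime q → ¬ q ∣ r → ∀ j b → q ^ j ∣ q ^ b * r → j ≤ b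
^∣^*⇒≤         q-prime q∤r zero    b       _ = z≤n
^∣^*⇒≤ {q} {r} q-prime q∤r (suc j) zero    qʲ⁺¹∣r =
  contradiction (subst (q ∣_) (*-identityˡ r) (m*n∣⇒m∣ q (q ^ j) qʲ⁺¹∣r)) q∤r
^∣^*⇒≤ {q} {r} q-prime q∤r (suc j) (suc b) qʲ⁺¹∣qᵇ⁺¹r = s≤s (^∣^*⇒≤ q-prime q∤r j b
  (*-cancelˡ-∣ q {{prime⇒nonZero q-prime}} (subst (q * q ^ j ∣_) (*-assoc q (q ^ b) r) qʲ⁺¹∣qᵇ⁺¹r)))

∣^*⇒∣ : ∀ {q e r} → Prime q → ¬ q ∣ e → ∀ b → e ∣ q ^ b * r → e ∣ r
∣^*⇒∣ {q} {e} {r} q-prime q∤e zero    e∣r      = subst (e ∣_) (*-identityˡ r) e∣r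
∣^*⇒∣ {q} {e} {r} q-prime q∤e (suc b) e∣qᵇ⁺¹r = ∣^*⇒∣ q-prime q∤e b
  (coprime-divisor (Coprime-sym (prime∤⇒coprime q-prime q∤e)) (subst (e ∣_) (*-assoc q (q ^ b) r) e∣qᵇ⁺¹r))

powerSum : ℤ → ℕ → ℤ
powerSum c zero    = 1ℤ
powerSum c (suc b) = powerSum c b ℤ.+ c ℤ.^ suc b

powerSum-0 : ∀ b → powerSum 0ℤ b ≡ 1ℤ
powerSum-0 zero    = refl
powerSum-0 (suc b) = trans (ℤₚ.+-identityʳ (powerSum 0ℤ b)) (powerSum-0 b)

module PrimePowerDivisors {q : ℕ} (q-prime : Prime q) {r : ℕ} (q∤r : ¬ q ∣ r) (1≤r : 1 ≤ r) where

  instance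
    q≢0 : NonZero q
    q≢0 = prime⇒nonZero q-prime

  layer : ℕ → List ℕ
  layer j = map (q ^ j *_) (divisors r)

  layers : ℕ → List ℕ
  layers zero    = layer 0
  layers (suc b) = layers b ++ layer (suc b)

  ∈-layers⁺ : ∀ {j e} b → j ≤ b → e ∣ r → q ^ j * e ∈ layers b
  ∈-layers⁺ {zero} zero    _   e∣r = ∈-map⁺ (q ^ 0 *_) (∈-divisors⁺ 1≤r e∣r)
  ∈-layers⁺        (suc b) j≤b e∣r with m≤n⇒m<n∨m≡n j≤b
  ... | inj₁ j<b  = ∈-++⁺ˡ (∈-layers⁺ b (≤-pred j<b) e∣r)
  ... | inj₂ refl = ∈-++⁺ʳ (layers b) (∈-map⁺ (q ^ suc b *_) (∈-divisors⁺ 1≤r e∣r))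

  ∈-layers⁻ : ∀ {d} b → d ∈ layers b → ∃₂ λ j e → j ≤ b × e ∣ r × d ≡ q ^ j * e
  ∈-layers⁻ zero    d∈ = let (e , e∈ , d≡) = ∈-map⁻ (q ^ 0 *_) d∈ in
    0 , e , z≤n , ∈-divisors⁻ r e∈ , d≡
  ∈-layers⁻ (suc b) d∈ with ∈-++⁻ (layers b) d∈
  ... | inj₁ d∈ˡ = let (j , e , j≤b , e∣r , d≡) = ∈-layers⁻ b d∈ˡ in
    j , e , m≤n⇒m≤1+n j≤b , e∣r , d≡
  ... | inj₂ d∈ʳ = let (e , e∈ , d≡) = ∈-map⁻ (q ^ suc b *_) d∈ʳ in
    suc b , e , ≤-refl , ∈-divisors⁻ r e∈ , d≡

  layer-unique : ∀ j → Unique (layer j)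
  layer-unique j = Uniqueₚ.map⁺ (*-cancelˡ-≡ _ _ (q ^ j) {{m^n≢0 q j}}) (divisors-unique r)

  layers-unique : ∀ b → Unique (layers b)
  layers-unique zero    = layer-unique 0
  layers-unique (suc b) = Uniqueₚ.++⁺ (layers-unique b) (layer-unique (suc b)) disjoint
    where
    q∤divisor : ∀ {e} → e ∣ r → ¬ q ∣ e
    q∤divisor e∣r q∣e = q∤r (∣-trans q∣e e∣r)
    disjoint : ∀ {d} → d ∈ layers b × d ∈ layer (suc b) → ⊥
    disjoint (d∈ˡ , d∈ʳ) with ∈-layers⁻ b d∈ˡ | ∈-map⁻ (q ^ suc b *_) d∈ʳ
    ... | j , e , j≤b , e∣r , d≡ | e′ , e′∈ , d≡′ = <-irrefl
      (^*-exponent-unique j (suc b) (trans (sym d≡) d≡′) (q∤divisor e∣r) (q∤divisor (∈-divisors⁻ r e′∈)))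
      (s≤s j≤b)

  ∈-divisors⇔∈-layers : ∀ b {d} → d ∈ divisors (q ^ b * r) ⇔ d ∈ layers b
  ∈-divisors⇔∈-layers b {d} = mk⇔ to from
    where
    1≤qᵇr : 1 ≤ q ^ b * r
    1≤qᵇr = ℕ.>-nonZero⁻¹ _ {{m*n≢0 (q ^ b) r {{m^n≢0 q b}} {{>-nonZero 1≤r}}}}
    to : d ∈ divisors (q ^ b * r) → d ∈ layers b
    to d∈ with factorOut (prime⇒1< q-prime) d (∣⇒≥1 (∈-divisors⁻ (q ^ b * r) d∈))
      where
      ∣⇒≥1 : d ∣ q ^ b * r → 1 ≤ d
      ∣⇒≥1 d∣ = n≢0⇒n>0 λ { refl → contradiction (0∣⇒≡0 d∣) (≢-nonZero⁻¹ _ {{>-nonZero 1≤qᵇr}}) }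
    ... | j , e , refl , q∤e = ∈-layers⁺ b
      (^∣^*⇒≤ q-prime q∤r j b (∣-trans (m∣m*n e) d∣qᵇr))
      (∣^*⇒∣ q-prime q∤e b (∣-trans (n∣m*n (q ^ j)) d∣qᵇr))
      where d∣qᵇr = ∈-divisors⁻ (q ^ b * r) d∈
    from : d ∈ layers b → d ∈ divisors (q ^ b * r)
    from d∈ with ∈-layers⁻ b d∈
    ... | j , e , j≤b , e∣r , refl = ∈-divisors⁺ 1≤qᵇr (*-pres-∣ (^-mono-∣ j≤b) e∣r)
      where
      ^-mono-∣ : ∀ {j b} → j ≤ b → q ^ j ∣ q ^ b
      ^-mono-∣ {j} {b} j≤b = divides (q ^ (b ∸ j))
        (trans (cong (q ^_) (sym (m∸n+n≡m j≤b))) (^-distribˡ-+-* q (b ∸ j) j))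

  divisorSum-primePower : ∀ f c → (∀ j e → f (q ^ j * e) ≡ c ℤ.^ j ℤ.* f e) →
                          ∀ b → sumℤ f (divisors (q ^ b * r)) ≡ powerSum c b ℤ.* sumℤ f (divisors r)
  divisorSum-primePower f c f-mult b = trans
    (sumℤ-unique-⇔ f (divisors-unique (q ^ b * r)) (layers-unique b) (∈-divisors⇔∈-layers b))
    (sum-layers b)
    where
    sum-layer : ∀ j → sumℤ f (layer j) ≡ c ℤ.^ j ℤ.* sumℤ f (divisors r)
    sum-layer j = begin
      sumℤ f (layer j)                                    ≡⟨ sumℤ-map f (q ^ j *_) (divisors r) ⟩
      sumℤ (λ e → f (q ^ j * e)) (divisors r)            ≡⟨ sumℤ-cong (divisors r) (f-mult j) ⟩
      sumℤ (λ e → c ℤ.^ j ℤ.* f e) (divisors r)          ≡⟨ sumℤ-*ˡ (c ℤ.^ j) f (divisors r) ⟩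
      c ℤ.^ j ℤ.* sumℤ f (divisors r)                    ∎
      where open ≡-Reasoning
    sum-layers : ∀ b → sumℤ f (layers b) ≡ powerSum c b ℤ.* sumℤ f (divisors r)
    sum-layers zero    = sum-layer 0
    sum-layers (suc b) = begin
      sumℤ f (layers b ++ layer (suc b))                  ≡⟨ sumℤ-++ f (layers b) (layer (suc b)) ⟩
      sumℤ f (layers b) ℤ.+ sumℤ f (layer (suc b))        ≡⟨ cong₂ ℤ._+_ (sum-layers b) (sum-layer (suc b)) ⟩
      powerSum c b ℤ.* s ℤ.+ c ℤ.^ suc b ℤ.* s            ≡⟨ ℤₚ.*-distribʳ-+ s (powerSum c b) (c ℤ.^ suc b) ⟨
      powerSum c (suc b) ℤ.* s                            ∎
      where
      open ≡-Reasoning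
      s = sumℤ f (divisors r)

-- Geometric sums with ratio ±X

geometric : ℕ → ℕ → ℕ
geometric X zero    = 1
geometric X (suc b) = geometric X b + X ^ suc b

alternating : ℕ → ℕ → ℕ
alternating X zero    = 1
alternating X (suc b) = X ^ suc b ∸ alternating X b

powerSum-pos : ∀ X b → powerSum (+ X) b ≡ + geometric X b
powerSum-pos X zero    = refl
powerSum-pos X (suc b) = cong₂ ℤ._+_ (powerSum-pos X b) (pos-^ X (suc b))

^≤geometric : ∀ X b → X ^ b ≤ geometric X b
^≤geometric X zero    = ≤-refl
^≤geometric X (suc b) = m≤n+m (X ^ suc b) (geometric X b)

alternating≤^ : ∀ X b → alternating X b ≤ X ^ b
alternating≤^ X zero    = ≤-refl
alternating≤^ X (suc b) = m∸n≤m (X ^ suc b) (alternating X b)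

powerSum-neg : ∀ X .{{_ : NonZero X}} b → powerSum (-1ℤ ℤ.* + X) b ≡ -1ℤ ℤ.^ b ℤ.* + alternating X b
powerSum-neg X zero    = refl
powerSum-neg X (suc b) = begin
  powerSum (-1ℤ ℤ.* + X) b ℤ.+ (-1ℤ ℤ.* + X) ℤ.^ suc b
    ≡⟨ cong₂ ℤ._+_ (powerSum-neg X b) last-term ⟩
  s ℤ.* + V ℤ.+ s′ ℤ.* + Y
    ≡⟨ flip-sign s (+ V) (+ Y) ⟩
  s′ ℤ.* (+ Y ℤ.- + V)
    ≡⟨ cong (s′ ℤ.*_) (trans (ℤₚ.m-n≡m⊖n Y V) (ℤₚ.⊖-≥ V≤Y)) ⟩
  s′ ℤ.* + (Y ∸ V) ∎
  where
  open ≡-Reasoning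
  s = -1ℤ ℤ.^ b
  s′ = -1ℤ ℤ.^ suc b
  V = alternating X b
  Y = X ^ suc b
  last-term : (-1ℤ ℤ.* + X) ℤ.^ suc b ≡ s′ ℤ.* + Y
  last-term = trans (ℤ-^-distribʳ-* -1ℤ (+ X) (suc b)) (cong (s′ ℤ.*_) (pos-^ X (suc b)))
  V≤Y : V ≤ Y
  V≤Y = ≤-trans (alternating≤^ X b) (m≤n*m (X ^ b) X)
  flip-sign : ∀ s v y → s ℤ.* v ℤ.+ (-1ℤ ℤ.* s) ℤ.* y ≡ (-1ℤ ℤ.* s) ℤ.* (y ℤ.- v)
  flip-sign = ℤ-solve-∀

alternating-lower : ∀ X b → X ^ b * (X ∸ 1) ≤ X * alternating X b
alternating-lower X zero    = subst₂ _≤_ (sym (*-identityˡ (X ∸ 1))) (sym (*-identityʳ X)) (m∸n≤m X 1)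
alternating-lower X (suc b) = begin
  Y * (X ∸ 1)         ≡⟨ *-distribˡ-∸ Y X 1 ⟩
  Y * X ∸ Y * 1       ≡⟨ cong₂ _∸_ (*-comm Y X) (*-identityʳ Y) ⟩
  X * Y ∸ Y           ≤⟨ ∸-monoʳ-≤ (X * Y) (*-monoʳ-≤ X (alternating≤^ X b)) ⟩
  X * Y ∸ X * V       ≡⟨ *-distribˡ-∸ X Y V ⟨
  X * (Y ∸ V)         ∎
  where
  open ≤-Reasoning
  Y = X ^ suc b
  V = alternating X b

powerSum-unit : ∀ {s} → IsUnit s → ∀ X .{{_ : NonZero X}} b →
                ∃ λ V → powerSum (s ℤ.* + X) b ≡ s ℤ.^ b ℤ.* + V × X ^ b * (X ∸ 1) ≤ X * V
powerSum-unit unit⁺ X b = geometric X b , identity , lower-bound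
  where
  identity : powerSum (1ℤ ℤ.* + X) b ≡ 1ℤ ℤ.^ b ℤ.* + geometric X b
  identity = begin
    powerSum (1ℤ ℤ.* + X) b      ≡⟨ cong (λ t → powerSum t b) (ℤₚ.*-identityˡ (+ X)) ⟩
    powerSum (+ X) b             ≡⟨ powerSum-pos X b ⟩
    + geometric X b              ≡⟨ ℤₚ.*-identityˡ _ ⟨
    1ℤ ℤ.* + geometric X b       ≡⟨ cong (ℤ._* + geometric X b) (ℤₚ.^-zeroˡ b) ⟨
    1ℤ ℤ.^ b ℤ.* + geometric X b ∎
    where open ≡-Reasoning
  lower-bound : X ^ b * (X ∸ 1) ≤ X * geometric X b
  lower-bound = begin
    X ^ b * (X ∸ 1)   ≤⟨ *-monoʳ-≤ (X ^ b) (m∸n≤m X 1) ⟩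
    X ^ b * X         ≡⟨ *-comm (X ^ b) X ⟩
    X * X ^ b         ≤⟨ *-monoʳ-≤ X (^≤geometric X b) ⟩
    X * geometric X b ∎
    where open ≤-Reasoning
powerSum-unit unit⁻ X b = alternating X b , powerSum-neg X b , alternating-lower X b

lower-bound⇒1≤ : ∀ {X b V} → 2 ≤ X → X ^ b * (X ∸ 1) ≤ X * V → 1 ≤ V
lower-bound⇒1≤ {V = suc _}              _   _     = s≤s z≤n
lower-bound⇒1≤ {suc zero}   {V = zero} (s≤s ()) _
lower-bound⇒1≤ {suc (suc Y)} {b} {zero} 2≤X lower = contradiction
  (subst (suc (suc Y) ^ b * suc Y ≤_) (*-zeroʳ (suc (suc Y))) lower)
  (<⇒≱ (ℕ.>-nonZero⁻¹ _ {{m*n≢0 (suc (suc Y) ^ b) (suc Y) {{m^n≢0 (suc (suc Y)) b}}}}))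

*-≤⇒^-≤ : ∀ {A X Y V} c v .{{_ : NonZero Y}} → A * Y ≤ X * V → X ^ v ≤ c * Y ^ v → A ^ v ≤ c * V ^ v
*-≤⇒^-≤ {A} {X} {Y} {V} c v AY≤XV Xᵛ≤cYᵛ = *-cancelʳ-≤ (A ^ v) (c * V ^ v) (Y ^ v) {{m^n≢0 Y v}} (begin
  A ^ v * Y ^ v         ≡⟨ ^-distribʳ-* A Y v ⟨
  (A * Y) ^ v           ≤⟨ ^-monoˡ-≤ v AY≤XV ⟩
  (X * V) ^ v           ≡⟨ ^-distribʳ-* X V v ⟩
  X ^ v * V ^ v         ≤⟨ *-monoˡ-≤ (V ^ v) Xᵛ≤cYᵛ ⟩
  c * Y ^ v * V ^ v     ≡⟨ regroup c (Y ^ v) (V ^ v) ⟩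
  c * V ^ v * Y ^ v     ∎)
  where
  open ≤-Reasoning
  regroup : ∀ a b c → a * b * c ≡ a * c * b
  regroup = solve-∀

^≤2^*[∸1]^ : ∀ {X} v → 2 ≤ X → X ^ v ≤ 2 ^ v * (X ∸ 1) ^ v
^≤2^*[∸1]^ {suc Y} v (s≤s 1≤Y) = begin
  suc Y ^ v         ≤⟨ ^-monoˡ-≤ v suc-Y≤2Y ⟩
  (2 * Y) ^ v       ≡⟨ ^-distribʳ-* 2 Y v ⟩
  2 ^ v * Y ^ v     ∎
  where
  open ≤-Reasoning
  suc-Y≤2Y : suc Y ≤ 2 * Y
  suc-Y≤2Y = subst₂ _≤_ (+-comm Y 1) (cong (λ z → Y + z) (sym (+-identityʳ Y))) (+-monoʳ-≤ Y 1≤Y)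

suc-^-suc-≤ : ∀ a w → suc a ^ suc w ≤ a ^ suc w + suc w * suc a ^ w
suc-^-suc-≤ a zero    = ≤-reflexive (+-comm 1 (a * 1))
suc-^-suc-≤ a (suc w) = begin
  suc a * suc a ^ suc w                               ≤⟨ *-monoʳ-≤ (suc a) (suc-^-suc-≤ a w) ⟩
  suc a * (A + suc w * P)                             ≡⟨ expand a A w P ⟩
  a * A + A + suc w * (suc a * P)                     ≤⟨ +-monoˡ-≤ (suc w * (suc a * P)) (+-monoʳ-≤ (a * A) A≤P′) ⟩
  a * A + suc a * P + suc w * (suc a * P)             ≡⟨ collect (a * A) (suc a * P) w ⟩
  a * A + suc (suc w) * (suc a * P)                   ∎
  where
  open ≤-Reasoning
  A = a ^ suc w
  P = suc a ^ w
  A≤P′ : A ≤ suc a * P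
  A≤P′ = ^-monoˡ-≤ (suc w) (n≤1+n a)
  expand : ∀ a A w P → suc a * (A + suc w * P) ≡ a * A + A + suc w * (suc a * P)
  expand = solve-∀
  collect : ∀ A B w → A + B + suc w * B ≡ A + suc (suc w) * B
  collect = solve-∀

suc-^≤2*^ : ∀ a v → 2 * v ≤ a → suc a ^ v ≤ 2 * a ^ v
suc-^≤2*^ a zero    _      = s≤s z≤n
suc-^≤2*^ a (suc w) 2v≤a = +-cancelʳ-≤ B B (2 * A) (begin
  B + B                               ≤⟨ +-mono-≤ (suc-^-suc-≤ a w) (suc-^-suc-≤ a w) ⟩
  (A + suc w * P) + (A + suc w * P)   ≡⟨ double A (suc w * P) ⟩
  2 * A + 2 * (suc w * P)             ≤⟨ +-monoʳ-≤ (2 * A) 2[suc-w*P]≤B ⟩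
  2 * A + B                           ∎)
  where
  open ≤-Reasoning
  P = suc a ^ w
  B = suc a ^ suc w
  A = a ^ suc w
  double : ∀ x y → (x + y) + (x + y) ≡ 2 * x + 2 * y
  double = solve-∀
  2[suc-w*P]≤B : 2 * (suc w * P) ≤ B
  2[suc-w*P]≤B = subst (_≤ B) (*-assoc 2 (suc w) P) (*-monoˡ-≤ P (≤-trans 2v≤a (n≤1+n a)))

module _ (P : ℕ → ℕ → Set)
         (P-1 : ∀ {t} → P t 1)
         (P-primePower : ∀ {t q b r} → Prime q → t ≤ q → 1 ≤ b → 1 ≤ r → ¬ q ∣ r → P (suc q) r →
                         P t (q ^ b * r))
  where

  -- Strong induction on m that splits off the least prime factor of m with its full multiplicity.
  roughInduction : ∀ m → 1 ≤ m → ∀ {t} → 2 ≤ t → t Rough m → P t m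
  roughInduction = <-rec (λ m → 1 ≤ m → ∀ {t} → 2 ≤ t → t Rough m → P t m) step
    where
    step : ∀ m → (∀ {r} → r < m → 1 ≤ r → ∀ {t} → 2 ≤ t → t Rough r → P t r) →
           1 ≤ m → ∀ {t} → 2 ≤ t → t Rough m → P t m
    step (suc zero)      _   _ _ _ = P-1
    step m@(suc (suc _)) rec _ {t} 2≤t t-rough = sweep (m ∸ t) refl ≤-refl t-rough
      where
      sweep : ∀ g {s} → m ∸ s ≡ g → t ≤ s → s Rough m → P t m
      sweep g {s} m∸s≡g t≤s s-rough with s ∣? m
      ... | yes s∣m = from-split (primePower-split 2≤s s∣m (s≤s z≤n))
        where
        2≤s = ≤-trans 2≤t t≤s
        instance
          s≢0 : NonZero s
          s≢0 = >-nonZero (≤-trans (s≤s z≤n) 2≤s)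
        s-prime : Prime s
        s-prime = rough∧∣⇒prime {{n>1⇒nonTrivial 2≤s}} s-rough s∣m
        from-split : (∃₂ λ b r → m ≡ s ^ b * r × 1 ≤ b × 1 ≤ r × ¬ s ∣ r) → P t m
        from-split (b , r , m≡sᵇr , 1≤b , 1≤r , s∤r) = subst (P t) (sym m≡sᵇr)
          (P-primePower s-prime t≤s 1≤b 1≤r s∤r (rec r<m 1≤r (m≤n⇒m≤1+n 2≤s) r-rough))
          where
          r<m : r < m
          r<m = subst (r <_) (trans (*-comm r (s ^ b)) (sym m≡sᵇr))
            (m<m*n r (s ^ b) {{>-nonZero 1≤r}} (≤-trans 2≤s (m≤m^n s 1≤b)))
          r-rough : suc s Rough r
          r-rough = ∤⇒rough-suc s∤r (rough∧∣⇒rough s-rough (subst (r ∣_) (sym m≡sᵇr) (n∣m*n (s ^ b))))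
      ... | no s∤m with g
      ...   | zero   = contradiction (subst (_∣ m) (sym s≡m) ∣-refl) s∤m
        where s≡m = ≤-antisym (rough⇒≤ s-rough) (m∸n≡0⇒m≤n m∸s≡g)
      ...   | suc g′ = sweep g′ (trans (sym (pred[m∸n]≡m∸[1+n] m s)) (cong ℕ.pred m∸s≡g))
                             (m≤n⇒m≤1+n t≤s) (∤⇒rough-suc s∤m s-rough)

module LegendreDivisorSum {p : ℕ} .{{_ : NonZero p}} (p-prime : Prime p) (p≢2 : p ≢ 2) (k : ℕ) where
  open QuadraticResidues p-prime using (legendre-*; legendre-∣; legendre-1; legendre-unit)

  χ : ℕ → ℤ
  χ d = legendre d p

  term : ℕ → ℤ
  term d = χ d ℤ.* + (d ^ k)

  S : ℕ → ℤ
  S n = legendreDivSum p k n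

  χ-^ : ∀ q b → χ (q ^ b) ≡ χ q ℤ.^ b
  χ-^ q zero    = legendre-1
  χ-^ q (suc b) = trans (legendre-* p≢2 q (q ^ b)) (cong (χ q ℤ.*_) (χ-^ q b))

  term-* : ∀ a b → term (a * b) ≡ term a ℤ.* term b
  term-* a b = begin
    χ (a * b) ℤ.* + ((a * b) ^ k)            ≡⟨ cong₂ ℤ._*_ (legendre-* p≢2 a b) (cong +_ (^-distribʳ-* a b k)) ⟩
    (χ a ℤ.* χ b) ℤ.* + (a ^ k * b ^ k)      ≡⟨ cong ((χ a ℤ.* χ b) ℤ.*_) (ℤₚ.pos-* (a ^ k) (b ^ k)) ⟩
    (χ a ℤ.* χ b) ℤ.* (+ (a ^ k) ℤ.* + (b ^ k)) ≡⟨ interchange (χ a) (χ b) (+ (a ^ k)) (+ (b ^ k)) ⟩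
    term a ℤ.* term b                        ∎
    where
    open ≡-Reasoning
    interchange : ∀ w x y z → (w ℤ.* x) ℤ.* (y ℤ.* z) ≡ (w ℤ.* y) ℤ.* (x ℤ.* z)
    interchange = ℤ-solve-∀

  term-^-* : ∀ q j e → term (q ^ j * e) ≡ term q ℤ.^ j ℤ.* term e
  term-^-* q zero    e = trans (cong term (*-identityˡ e)) (sym (ℤₚ.*-identityˡ (term e)))
  term-^-* q (suc j) e = begin
    term (q * q ^ j * e)                      ≡⟨ cong term (*-assoc q (q ^ j) e) ⟩
    term (q * (q ^ j * e))                    ≡⟨ term-* q (q ^ j * e) ⟩
    term q ℤ.* term (q ^ j * e)               ≡⟨ cong (term q ℤ.*_) (term-^-* q j e) ⟩
    term q ℤ.* (term q ℤ.^ j ℤ.* term e)      ≡⟨ ℤₚ.*-assoc (term q) (term q ℤ.^ j) (term e) ⟨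
    term q ℤ.^ suc j ℤ.* term e               ∎
    where open ≡-Reasoning

  S-1 : S 1 ≡ 1ℤ
  S-1 = cong₂ (λ c n → c ℤ.* + n ℤ.+ 0ℤ) legendre-1 (^-zeroˡ k)

  S-primePower : ∀ {q r} → Prime q → ¬ q ∣ r → 1 ≤ r → ∀ b → S (q ^ b * r) ≡ powerSum (term q) b ℤ.* S r
  S-primePower {q} q-prime q∤r 1≤r =
    PrimePowerDivisors.divisorSum-primePower q-prime q∤r 1≤r term (term q) (term-^-* q)

  S-p^a* : ∀ a {m} → ¬ p ∣ m → 1 ≤ m → S (p ^ a * m) ≡ S m
  S-p^a* a {m} p∤m 1≤m = begin
    S (p ^ a * m)                 ≡⟨ S-primePower p-prime p∤m 1≤m a ⟩
    powerSum (term p) a ℤ.* S m   ≡⟨ cong (λ c → powerSum (c ℤ.* + (p ^ k)) a ℤ.* S m) (legendre-∣ ∣-refl) ⟩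
    powerSum 0ℤ a ℤ.* S m         ≡⟨ cong (ℤ._* S m) (powerSum-0 a) ⟩
    1ℤ ℤ.* S m                    ≡⟨ ℤₚ.*-identityˡ (S m) ⟩
    S m                           ∎
    where open ≡-Reasoning

  record Multiplier (q b r : ℕ) : Set where
    field
      V     : ℕ
      S-≡   : S (q ^ b * r) ≡ (χ q ℤ.^ b ℤ.* + V) ℤ.* S r
      lower : (q ^ k) ^ b * (q ^ k ∸ 1) ≤ q ^ k * V

  S-coprime-primePower : ∀ {q r} → Prime q → ¬ p ∣ q → ¬ q ∣ r → 1 ≤ r → ∀ b → Multiplier q b r
  S-coprime-primePower {q} {r} q-prime p∤q q∤r 1≤r b
    with powerSum-unit (legendre-unit p∤q) (q ^ k) {{m^n≢0 q k {{prime⇒nonZero q-prime}}}} b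
  ... | V , powerSum≡ , lower = record
    { V = V ; S-≡ = trans (S-primePower q-prime q∤r 1≤r b) (cong (ℤ._* S r) powerSum≡) ; lower = lower }

  private
    p∤primePower : ∀ {q b r} → 1 ≤ b → ¬ p ∣ q ^ b * r → ¬ p ∣ q
    p∤primePower {q} {suc b} {r} _ p∤qᵇr p∣q = p∤qᵇr (∣-trans p∣q (∣-trans (m∣m*n (q ^ b)) (m∣m*n r)))

    p∤cofactor : ∀ {q b r} → ¬ p ∣ q ^ b * r → ¬ p ∣ r
    p∤cofactor {q} {b} p∤qᵇr p∣r = p∤qᵇr (∣n⇒∣m*n (q ^ b) p∣r)

  sgn-S : 1 ≤ k → ∀ m → 1 ≤ m → ¬ p ∣ m → sgn (S m) ≡ χ m
  sgn-S 1≤k m 1≤m = roughInduction (λ _ m → ¬ p ∣ m → sgn (S m) ≡ χ m)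
    (λ _ → trans (cong sgn S-1) (sym legendre-1)) step m 1≤m ≤-refl 2-rough
    where
    step : ∀ {t q b r} → Prime q → t ≤ q → 1 ≤ b → 1 ≤ r → ¬ q ∣ r → (¬ p ∣ r → sgn (S r) ≡ χ r) →
           ¬ p ∣ q ^ b * r → sgn (S (q ^ b * r)) ≡ χ (q ^ b * r)
    step {t} {q} {b} {r} q-prime _ 1≤b 1≤r q∤r ih p∤qᵇr = begin
      sgn (S (q ^ b * r))                           ≡⟨ cong sgn S-≡ ⟩
      sgn ((χ q ℤ.^ b ℤ.* + V) ℤ.* S r)             ≡⟨ sgn-* (χ q ℤ.^ b ℤ.* + V) (S r) ⟩
      sgn (χ q ℤ.^ b ℤ.* + V) ℤ.* sgn (S r)         ≡⟨ cong₂ ℤ._*_ (sgn-unit-* (IsUnit-^ (legendre-unit p∤q) b) 1≤V)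
                                                                   (ih (p∤cofactor {q} {b} p∤qᵇr)) ⟩
      χ q ℤ.^ b ℤ.* χ r                             ≡⟨ cong (ℤ._* χ r) (χ-^ q b) ⟨
      χ (q ^ b) ℤ.* χ r                             ≡⟨ legendre-* p≢2 (q ^ b) r ⟨
      χ (q ^ b * r)                                 ∎
      where
      open ≡-Reasoning
      p∤q = p∤primePower {q} {b} {r} 1≤b p∤qᵇr
      open Multiplier (S-coprime-primePower q-prime p∤q q∤r 1≤r b)
      2≤X : 2 ≤ q ^ k
      2≤X = ≤-trans (prime⇒1< q-prime) (m≤m^n q {{prime⇒nonZero q-prime}} 1≤k)
      1≤V = lower-bound⇒1≤ {b = b} 2≤X lower

  module Bound (1≤k : 1 ≤ k) (u v : ℕ) (1≤u : 1 ≤ u) where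

    instance
      2ᵛ≢0 : NonZero (2 ^ v)
      2ᵛ≢0 = m^n≢0 2 v

    -- A factor 2^v is reserved for each prime q with t ≤ q < 2v + 1; for larger q the loss
    -- (q^k / (q^k - 1))^v ≤ 2 is absorbed by q^u instead.
    K : ℕ → ℕ
    K t = (2 ^ v) ^ (suc (2 * v) ∸ t)

    1≤K : ∀ t → 1 ≤ K t
    1≤K t = m^n>0 (2 ^ v) (suc (2 * v) ∸ t)

    K-antitone : ∀ {t q} → t ≤ q → K q ≤ K t
    K-antitone {t} t≤q = ^-monoʳ-≤ (2 ^ v) (∸-monoʳ-≤ (suc (2 * v)) t≤q)

    primePower-bound : ∀ {t q b V} → Prime q → t ≤ q → 1 ≤ b → (q ^ k) ^ b * (q ^ k ∸ 1) ≤ q ^ k * V →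
                       ((q ^ k) ^ b) ^ v * K (suc q) ≤ K t * V ^ v * (q ^ b) ^ u
    primePower-bound {t} {q} {b} {V} q-prime t≤q 1≤b lower = by-size (q <? suc (2 * v))
      where
      instance
        q≢0 : NonZero q
        q≢0 = prime⇒nonZero q-prime
      A = ((q ^ k) ^ b) ^ v
      Mu = (q ^ b) ^ u
      q≤X : q ≤ q ^ k
      q≤X = m≤m^n q 1≤k
      2≤X : 2 ≤ q ^ k
      2≤X = ≤-trans (prime⇒1< q-prime) q≤X
      instance
        X∸1≢0 : NonZero (q ^ k ∸ 1)
        X∸1≢0 = >-nonZero (∸-monoˡ-≤ 1 2≤X)
      2≤Mu : 2 ≤ Mu
      2≤Mu = ≤-trans (prime⇒1< q-prime) (≤-trans (m≤m^n q 1≤b) (m≤m^n (q ^ b) {{m^n≢0 q b}} 1≤u))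
      by-size : Dec (q < suc (2 * v)) → A * K (suc q) ≤ K t * V ^ v * Mu
      by-size (yes q<2v+1) = begin
        A * K (suc q)                 ≤⟨ *-monoˡ-≤ (K (suc q)) (*-≤⇒^-≤ (2 ^ v) v lower (^≤2^*[∸1]^ v 2≤X)) ⟩
        2 ^ v * V ^ v * K (suc q)     ≡⟨ regroup (2 ^ v) (V ^ v) (K (suc q)) ⟩
        2 ^ v * K (suc q) * V ^ v     ≡⟨ cong (λ e → (2 ^ v) ^ e * V ^ v) (+-∸-assoc 1 (≤-pred q<2v+1)) ⟨
        K q * V ^ v                   ≤⟨ *-monoˡ-≤ (V ^ v) (K-antitone t≤q) ⟩
        K t * V ^ v                   ≤⟨ m≤m*n (K t * V ^ v) Mu {{>-nonZero (≤-trans (s≤s z≤n) 2≤Mu)}} ⟩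
        K t * V ^ v * Mu              ∎
        where
        open ≤-Reasoning
        regroup : ∀ a b c → a * b * c ≡ a * c * b
        regroup = solve-∀
      by-size (no q≮2v+1) = begin
        A * K (suc q)                 ≡⟨ cong (λ e → A * (2 ^ v) ^ e) (m≤n⇒m∸n≡0 2v+1≤suc-q) ⟩
        A * 1                         ≡⟨ *-identityʳ A ⟩
        A                             ≤⟨ *-≤⇒^-≤ 2 v lower Xᵛ≤2[X∸1]ᵛ ⟩
        2 * V ^ v                     ≤⟨ *-monoˡ-≤ (V ^ v) 2≤Mu ⟩
        Mu * V ^ v                    ≡⟨ *-comm Mu (V ^ v) ⟩
        V ^ v * Mu                    ≤⟨ *-monoˡ-≤ Mu (m≤n*m (V ^ v) (K t) {{>-nonZero (1≤K t)}}) ⟩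
        K t * V ^ v * Mu              ∎
        where
        open ≤-Reasoning
        2v+1≤suc-q : suc (2 * v) ≤ suc q
        2v+1≤suc-q = ≤-trans (≮⇒≥ q≮2v+1) (n≤1+n q)
        Xᵛ≤2[X∸1]ᵛ : (q ^ k) ^ v ≤ 2 * (q ^ k ∸ 1) ^ v
        Xᵛ≤2[X∸1]ᵛ = subst (λ X → X ^ v ≤ 2 * (q ^ k ∸ 1) ^ v) (m+[n∸m]≡n (≤-trans (s≤s z≤n) 2≤X))
          (suc-^≤2*^ (q ^ k ∸ 1) v (∸-monoˡ-≤ 1 (≤-trans (≮⇒≥ q≮2v+1) q≤X)))

    Bounded : ℕ → ℕ → Set
    Bounded t m = m ^ (k * v) ≤ K t * ∣ S m ∣ ^ v * m ^ u

    S-bound : ∀ m → 1 ≤ m → ¬ p ∣ m → Bounded 2 m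
    S-bound m 1≤m =
      roughInduction (λ t m → ¬ p ∣ m → Bounded t m) (λ {t} _ → bounded-1 {t}) step m 1≤m ≤-refl 2-rough
      where
      bounded-1 : ∀ {t} → Bounded t 1
      bounded-1 {t} = begin
        1 ^ (k * v)                 ≡⟨ ^-zeroˡ (k * v) ⟩
        1                           ≤⟨ 1≤K t ⟩
        K t                         ≡⟨ trans (*-identityʳ (K t * 1)) (*-identityʳ (K t)) ⟨
        K t * 1 * 1                 ≡⟨ cong₂ (λ x y → K t * x * y)
                                        (trans (sym (^-zeroˡ v)) (cong (λ s → ∣ s ∣ ^ v) (sym S-1))) (sym (^-zeroˡ u)) ⟩
        K t * ∣ S 1 ∣ ^ v * 1 ^ u   ∎
        where open ≤-Reasoning

      step : ∀ {t q b r} → Prime q → t ≤ q → 1 ≤ b → 1 ≤ r → ¬ q ∣ r → (¬ p ∣ r → Bounded (suc q) r) →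
             ¬ p ∣ q ^ b * r → Bounded t (q ^ b * r)
      step {t} {q} {b} {r} q-prime t≤q 1≤b 1≤r q∤r ih p∤qᵇr = begin
        (q ^ b * r) ^ (k * v)                     ≡⟨ split-power ⟩
        A * r ^ (k * v)                           ≤⟨ *-monoʳ-≤ A (ih (p∤cofactor {q} {b} p∤qᵇr)) ⟩
        A * (K (suc q) * W ^ v * r ^ u)           ≡⟨ regroup A (K (suc q)) (W ^ v) (r ^ u) ⟩
        A * K (suc q) * (W ^ v * r ^ u)
          ≤⟨ *-monoˡ-≤ (W ^ v * r ^ u) (primePower-bound q-prime t≤q 1≤b lower) ⟩
        K t * V ^ v * (q ^ b) ^ u * (W ^ v * r ^ u) ≡⟨ regroup′ (K t) (V ^ v) ((q ^ b) ^ u) (W ^ v) (r ^ u) ⟩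
        K t * (V ^ v * W ^ v) * ((q ^ b) ^ u * r ^ u)
          ≡⟨ cong₂ (λ x y → K t * x * y) (sym (^-distribʳ-* V W v)) (sym (^-distribʳ-* (q ^ b) r u)) ⟩
        K t * (V * W) ^ v * (q ^ b * r) ^ u      ≡⟨ cong (λ x → K t * x ^ v * (q ^ b * r) ^ u) ∣S∣≡ ⟨
        K t * ∣ S (q ^ b * r) ∣ ^ v * (q ^ b * r) ^ u ∎
        where
        open ≤-Reasoning
        open Multiplier (S-coprime-primePower q-prime (p∤primePower {q} {b} {r} 1≤b p∤qᵇr) q∤r 1≤r b)
        A = ((q ^ k) ^ b) ^ v
        W = ∣ S r ∣
        ∣S∣≡ : ∣ S (q ^ b * r) ∣ ≡ V * W
        ∣S∣≡ = trans (cong ∣_∣ S-≡) (trans (ℤₚ.abs-* (χ q ℤ.^ b ℤ.* + V) (S r))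
                 (cong (_* W) (∣unit-*∣ V (IsUnit-^ (legendre-unit (p∤primePower {q} {b} {r} 1≤b p∤qᵇr)) b))))
        exponents : ∀ b k v → b * (k * v) ≡ k * (b * v)
        exponents = solve-∀
        split-power : (q ^ b * r) ^ (k * v) ≡ A * r ^ (k * v)
        split-power = trans (^-distribʳ-* (q ^ b) r (k * v)) (cong (_* r ^ (k * v)) (begin-equality
          (q ^ b) ^ (k * v)    ≡⟨ ^-*-assoc q b (k * v) ⟩
          q ^ (b * (k * v))    ≡⟨ cong (q ^_) (exponents b k v) ⟩
          q ^ (k * (b * v))    ≡⟨ ^-*-assoc q k (b * v) ⟨
          (q ^ k) ^ (b * v)    ≡⟨ ^-*-assoc (q ^ k) b v ⟨
          A                    ∎))
        regroup : ∀ a c w s → a * (c * w * s) ≡ a * c * (w * s)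
        regroup = solve-∀
        regroup′ : ∀ c x y w s → c * x * y * (w * s) ≡ c * (x * w) * (y * s)
        regroup′ = solve-∀

lemma7p1 : (p : ℕ) .{{_ : NonZero p}} → Prime p → p ≢ 2 →
           (k a : ℕ) → 1 ≤ k →
           ((u v : ℕ) → 1 ≤ u → 1 ≤ v →
             Σ ℕ (λ N → 1 ≤ N × ((m : ℕ) → 1 ≤ m → ¬ (p ∣ m) →
               m ^ (k * v) ≤ N * (∣ legendreDivSum p k (p ^ a * m) ∣ ^ v) * m ^ u)))
           × ((m : ℕ) → 1 ≤ m → ¬ (p ∣ m) →
               sgn (legendreDivSum p k (p ^ a * m)) ≡ legendre m p)
lemma7p1 p p-prime p≢2 k a 1≤k = bound , sign
  where
  open LegendreDivisorSum p-prime p≢2 k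
  bound : (u v : ℕ) → 1 ≤ u → 1 ≤ v →
          Σ ℕ (λ N → 1 ≤ N × ((m : ℕ) → 1 ≤ m → ¬ (p ∣ m) →
            m ^ (k * v) ≤ N * ∣ S (p ^ a * m) ∣ ^ v * m ^ u))
  bound u v 1≤u _ = K 2 , 1≤K 2 , λ m 1≤m p∤m →
    subst (λ s → m ^ (k * v) ≤ K 2 * ∣ s ∣ ^ v * m ^ u) (sym (S-p^a* a p∤m 1≤m)) (S-bound m 1≤m p∤m)
    where open Bound 1≤k u v 1≤u
  sign : (m : ℕ) → 1 ≤ m → ¬ (p ∣ m) → sgn (S (p ^ a * m)) ≡ legendre m p
  sign m 1≤m p∤m = trans (cong sgn (S-p^a* a p∤m 1≤m)) (sgn-S 1≤k m 1≤m p∤m)
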